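{- Let $c\in(0,1]$ and let $m,N$ be integers with $1\le m\le cN/100$. Let $G$ be a $c$-expander on $N$ vertices with minimum degree $\delta(G)\ge3$, and let $E_0\subseteq E(G)$ with $|E_0|=m$. Then there exists a subgraph $G'$ of $G\setminus E_0$ such that: $|V(G')|\ge N/2$; $\delta(G')\ge2$; $G'$ contains at least $N/4$ vertices of degree at least $3$; and $G'$ is a $c/10$-expander.
   Context: For a graph $H$ and $S\subseteq V(H)$, let $\Phi(S)=e(S,S^c)/d(S)$ where $d(S)=\sum_{v\in S}d(v)$ and $S^c=V(H)\setminus S$. $H$ is a $c$-expander if $\Phi(S)\ge c$ for every nonempty $S\subseteq V(H)$ with $|S|\le|V(H)|/2$.
   Formalization: The parameter c ranges over the rationals in $(0,1]$. -}

module Defs where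

open import Data.Nat as ℕ using (ℕ; zero; suc; _+_; _*_; _≤_; _<ᵇ_; _≤ᵇ_)
open import Data.Fin using (Fin; zero; suc; toℕ)
open import Data.Bool using (Bool; true; false; if_then_else_; _∧_; not)
open import Data.Integer using (+_)
open import Data.Rational as ℚ using (ℚ)
open import Data.Product using (Σ; _×_; ∃)
open import Relation.Binary.PropositionalEquality using (_≡_)

ℕ→ℚ : ℕ → ℚ
ℕ→ℚ n = (+ n) ℚ./ 1

sumF : ∀ {n} → (Fin n → ℕ) → ℕ
sumF {zero}  f = 0
sumF {suc n} f = f zero + sumF (λ i → f (suc i))

countB : ∀ {n} → (Fin n → Bool) → ℕ
countB p = sumF (λ i → if p i then 1 else 0)

record Graph (n : ℕ) : Set where
  field
    adj    : Fin n → Fin n → Bool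
    sym    : ∀ i j → adj i j ≡ adj j i
    irrefl : ∀ i → adj i i ≡ false
open Graph public

VSet : ℕ → Set
VSet n = Fin n → Bool

_⊆ᵥ_ : ∀ {n} → VSet n → VSet n → Set
S ⊆ᵥ T = ∀ v → S v ≡ true → T v ≡ true

NonEmpty : ∀ {n} → VSet n → Set
NonEmpty {n} S = ∃ λ (v : Fin n) → S v ≡ true

all : ∀ {n} → VSet n
all _ = true

_∖_ : ∀ {n} → VSet n → VSet n → VSet n
(V ∖ S) v = V v ∧ not (S v)

deg : ∀ {n} → Graph n → Fin n → ℕ
deg G v = countB (adj G v)

edgeCount : ∀ {n} → Graph n → ℕ
edgeCount G = sumF (λ i → countB (λ j → (toℕ i <ᵇ toℕ j) ∧ adj G i j))

volume : ∀ {n} → Graph n → VSet n → ℕ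
volume G S = sumF (λ v → if S v then deg G v else 0)

-- e(S,T) = number of edges with one end in S and the other in T (S, T disjoint)
eBetween : ∀ {n} → Graph n → VSet n → VSet n → ℕ
eBetween G S T = sumF (λ i → countB (λ j → S i ∧ T j ∧ adj G i j))

-- G is a c-expander, where G has vertex set V (all edges of G lie inside V):
-- Φ(S) = e(S, V∖S)/d(S) ≥ c for every nonempty S ⊆ V with |S| ≤ |V|/2,
-- written multiplicatively as c · d(S) ≤ e(S, V∖S).
IsExpanderOn : ∀ {n} → ℚ → VSet n → Graph n → Set
IsExpanderOn c V G =
  ∀ (S : VSet _) → S ⊆ᵥ V → NonEmpty S → 2 * countB S ≤ countB V →
  c ℚ.* ℕ→ℚ (volume G S) ℚ.≤ ℕ→ℚ (eBetween G S (V ∖ S))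

IsExpander : ∀ {n} → ℚ → Graph n → Set
IsExpander c G = IsExpanderOn c all G

MinDegOn≥ : ∀ {n} → VSet n → Graph n → ℕ → Set
MinDegOn≥ V G k = ∀ v → V v ≡ true → k ≤ deg G v

IsSubgraphMinus : ∀ {n} → Graph n → Graph n → VSet n → Graph n → Set
IsSubgraphMinus G E₀ V H =
  ∀ i j → adj H i j ≡ true →
    (V i ≡ true) × (adj G i j ≡ true) × (adj E₀ i j ≡ false)

_⊆ₑ_ : ∀ {n} → Graph n → Graph n → Set
E ⊆ₑ G = ∀ i j → adj E i j ≡ true → adj G i j ≡ true

-- Write c = p/q and H = G ∖ E₀. Among the sets U with |U| ≤ N/2 pick one minimising the potential
--   Ψ(U) = 10q·e_H(U, Uᶜ) + p·d_H(Uᶜ) + 10q·d_{E₀}(Uᶜ),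
-- and let G' be the subgraph of H induced on V = Uᶜ. Comparing Ψ(U) with Ψ(∅), and using the
-- expansion of G on U, shows that U is tiny (135|U| ≤ 2N) and e_H(U, V) ≤ (11/9)·2|E₀|. Comparing
-- Ψ(U) with Ψ(U ∪ S) for S ⊆ V such that U ∪ S is still at most half of the vertices gives
--   10q·e_H(U, S) + p·d_H(S) + 10q·d_{E₀}(S) ≤ 10q·e_H(S, V ∖ S).
-- For a single vertex S this yields δ(G') ≥ 2, and for S of small G-volume it is the c/10-expansion
-- of G'; a set S of large volume instead expands in G and loses at most e_H(U, V) + 2|E₀| of its
-- boundary. Every vertex of V of G'-degree at most 2 has lost an edge to U or to E₀, so there are at
-- most e_H(U, V) + 2|E₀| ≤ 2N/45 of them, leaving at least N/4 vertices of degree at least 3.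

module Submission where

open import Defs
open import Data.Nat using (ℕ; _≤_; _*_; _≤ᵇ_)
open import Data.Bool using (_∧_)
open import Data.Integer using (+_)
open import Data.Rational using (ℚ; _<_; _/_)
open import Data.Product using (Σ; _×_)
open import Relation.Binary.PropositionalEquality using (_≡_)
import Data.Rational as Q

open import Data.Nat using (zero; suc; _+_; _≡ᵇ_; _<ᵇ_; z≤n; s≤s; NonZero) renaming (_<_ to _<ℕ_)
open import Data.Nat.Properties hiding (_≟_)
open import Data.Fin using (Fin; zero; suc; toℕ)
open import Data.Fin.Properties using (toℕ-injective; any?)
open import Data.Bool using (Bool; true; false; if_then_else_; _∨_; not; T; _≟_)
open import Data.Bool.Properties using (∧-identityʳ; ∧-zeroʳ; T-≡)
open import Function.Bundles using (Equivalence)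
open import Data.Product using (_,_; proj₁; proj₂)
open import Data.Empty using (⊥-elim)
open import Data.List using (_∷_; [])
open import Relation.Nullary using (¬_; Dec; yes; no)
open import Relation.Binary.PropositionalEquality
  using (refl; trans; cong; cong₂; subst; subst₂; module ≡-Reasoning) renaming (sym to ≡-sym)
open import Data.Nat.Tactic.RingSolver using (solve)
open import Algebra.Properties.CommutativeSemigroup +-commutativeSemigroup using (interchange)
open import Data.Integer using (+≤+)
import Data.Integer as ℤ
import Data.Integer.Properties as ℤₚ
open import Data.Rational using (mkℚ; toℚᵘ)
import Data.Rational.Properties as ℚₚ
open import Data.Rational.Unnormalised using (mkℚᵘ; _≃_; *≤*)
import Data.Rational.Unnormalised.Properties as ℚᵘₚ
open import Data.Nat.Coprimality using (Coprime; 1-coprimeTo)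
import Data.Nat.Coprimality as Coprimality

private
  variable
    n : ℕ

ind : Bool → ℕ
ind b = if b then 1 else 0

sumF-cong : {f g : Fin n → ℕ} → (∀ i → f i ≡ g i) → sumF f ≡ sumF g
sumF-cong {zero}  f≗g = refl
sumF-cong {suc n} f≗g = cong₂ _+_ (f≗g zero) (sumF-cong (λ i → f≗g (suc i)))

sumF-zero : ∀ n → sumF {n} (λ _ → 0) ≡ 0
sumF-zero zero    = refl
sumF-zero (suc n) = sumF-zero n

sumF-+ : (f g : Fin n → ℕ) → sumF (λ i → f i + g i) ≡ sumF f + sumF g
sumF-+ {zero}  f g = refl
sumF-+ {suc n} f g = begin
  f zero + g zero + sumF (λ i → f (suc i) + g (suc i))
    ≡⟨ cong (_+_ (f zero + g zero)) (sumF-+ (λ i → f (suc i)) (λ i → g (suc i))) ⟩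
  f zero + g zero + (sumF (λ i → f (suc i)) + sumF (λ i → g (suc i)))
    ≡⟨ interchange (f zero) (g zero) _ _ ⟩
  f zero + sumF (λ i → f (suc i)) + (g zero + sumF (λ i → g (suc i))) ∎
  where open ≡-Reasoning

sumF-mono-≤ : {f g : Fin n → ℕ} → (∀ i → f i ≤ g i) → sumF f ≤ sumF g
sumF-mono-≤ {zero}  f≤g = z≤n
sumF-mono-≤ {suc n} f≤g = +-mono-≤ (f≤g zero) (sumF-mono-≤ (λ i → f≤g (suc i)))

sumF-comm : ∀ {m} (f : Fin m → Fin n → ℕ) →
            sumF (λ i → sumF (f i)) ≡ sumF (λ j → sumF (λ i → f i j))
sumF-comm {n} {zero}  f = ≡-sym (sumF-zero n)
sumF-comm {n} {suc m} f = begin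
  sumF (f zero) + sumF (λ i → sumF (f (suc i)))
    ≡⟨ cong (_+_ (sumF (f zero))) (sumF-comm (λ i → f (suc i))) ⟩
  sumF (f zero) + sumF (λ j → sumF (λ i → f (suc i) j))
    ≡⟨ ≡-sym (sumF-+ (f zero) _) ⟩
  sumF (λ j → sumF (λ i → f i j)) ∎
  where open ≡-Reasoning

sumF-const-on : (S : VSet n) (k : ℕ) → sumF (λ v → if S v then k else 0) ≡ k * countB S
sumF-const-on {zero}  S k = ≡-sym (*-zeroʳ k)
sumF-const-on {suc n} S k =
  trans (cong₂ _+_ (k-times-ind (S zero)) (sumF-const-on (λ v → S (suc v)) k))
        (≡-sym (*-distribˡ-+ k (ind (S zero)) _))
  where
  k-times-ind : ∀ b → (if b then k else 0) ≡ k * ind b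
  k-times-ind false = ≡-sym (*-zeroʳ k)
  k-times-ind true  = ≡-sym (*-identityʳ k)

if-mono : ∀ {a b} s → (s ≡ true → a ≤ b) → (if s then a else 0) ≤ (if s then b else 0)
if-mono false _   = z≤n
if-mono true  a≤b = a≤b refl

∅ᵥ : VSet n
∅ᵥ _ = false

∁ : VSet n → VSet n
∁ S v = not (S v)

_∪ᵥ_ : VSet n → VSet n → VSet n
(S ∪ᵥ T) v = S v ∨ T v

⁅_⁆ : Fin n → VSet n
⁅ v ⁆ u = toℕ u ≡ᵇ toℕ v

sumF-⁅⁆ : (f : Fin n → ℕ) (v : Fin n) → sumF (λ u → if ⁅ v ⁆ u then f u else 0) ≡ f v
sumF-⁅⁆ {suc n} f zero    = trans (cong (_+_ (f zero)) (sumF-zero n)) (+-identityʳ (f zero))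
sumF-⁅⁆ {suc n} f (suc v) = sumF-⁅⁆ (λ u → f (suc u)) v

⁅⁆⊆ : ∀ {V : VSet n} {v} → V v ≡ true → ⁅ v ⁆ ⊆ᵥ V
⁅⁆⊆ {V = V} {v} Vv u u≡v =
  subst (λ w → V w ≡ true) (≡-sym (toℕ-injective (≡ᵇ⇒≡ (toℕ u) (toℕ v) (Equivalence.from T-≡ u≡v)))) Vv

nonEmpty? : (S : VSet n) → Dec (NonEmpty S)
nonEmpty? S = any? (λ v → S v ≟ true)

¬NonEmpty⇒∅ : ∀ {S : VSet n} → ¬ NonEmpty S → ∀ v → S v ≡ false
¬NonEmpty⇒∅ {S = S} S=∅ v with S v in Sv
... | true  = ⊥-elim (S=∅ (v , Sv))
... | false = refl

record _≐_⊎_ (A B C : VSet n) : Set where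
  field
    ind-+ : ∀ v → ind (A v) ≡ ind (B v) + ind (C v)
open _≐_⊎_

all≐⊎∁ : (S : VSet n) → all ≐ S ⊎ ∁ S
all≐⊎∁ S .ind-+ v with S v
... | true  = refl
... | false = refl

⊆⇒≐⊎∖ : ∀ {S V : VSet n} → S ⊆ᵥ V → V ≐ S ⊎ (V ∖ S)
⊆⇒≐⊎∖ {S = S} {V} S⊆V .ind-+ v with S v in Sv | V v in Vv
... | false | false = refl
... | false | true  = refl
... | true  | true  = refl
... | true  | false with trans (≡-sym Vv) (S⊆V v Sv)
...   | ()

⊆∁⇒∪≐⊎ : ∀ {U S : VSet n} → S ⊆ᵥ ∁ U → (U ∪ᵥ S) ≐ U ⊎ S
⊆∁⇒∪≐⊎ {U = U} {S} S⊆∁U .ind-+ v with U v in Uv | S v in Sv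
... | false | _     = refl
... | true  | false = refl
... | true  | true  with trans (≡-sym (cong not Uv)) (S⊆∁U v Sv)
...   | ()

⊆∁⇒∁≐⊎∖ : ∀ {U S : VSet n} → S ⊆ᵥ ∁ U → ∁ S ≐ U ⊎ (∁ U ∖ S)
⊆∁⇒∁≐⊎∖ {U = U} {S} S⊆∁U .ind-+ v with U v in Uv | S v in Sv
... | false | false = refl
... | false | true  = refl
... | true  | false = refl
... | true  | true  with trans (≡-sym (cong not Uv)) (S⊆∁U v Sv)
...   | ()

≐-split : (V : VSet n) (P : Fin n → Bool) → V ≐ (λ v → V v ∧ P v) ⊎ (λ v → V v ∧ not (P v))
≐-split V P .ind-+ v with V v | P v
... | false | _     = refl
... | true  | true  = refl
... | true  | false = refl

∁-∪ : (U S : VSet n) → ∀ v → ∁ (U ∪ᵥ S) v ≡ (∁ U ∖ S) v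
∁-∪ U S v with U v
... | true  = refl
... | false = refl

∖⊆ : (V S : VSet n) → (V ∖ S) ⊆ᵥ V
∖⊆ V S v h with V v
... | true  = refl
... | false = h

⊆ᵥ-refl : (S : VSet n) → S ⊆ᵥ S
⊆ᵥ-refl S _ v = v

⊆all : (S : VSet n) → S ⊆ᵥ all
⊆all S _ _ = refl

ind-mono : ∀ {a b} → (a ≡ true → b ≡ true) → ind a ≤ ind b
ind-mono {false} _   = z≤n
ind-mono {true}  a⇒b rewrite a⇒b refl = ≤-refl

countB-all : ∀ n → countB {n} all ≡ n
countB-all zero    = refl
countB-all (suc n) = cong suc (countB-all n)

countB-cong : ∀ {S S' : VSet n} → (∀ v → S v ≡ S' v) → countB S ≡ countB S'
countB-cong S≗S' = sumF-cong (λ v → cong ind (S≗S' v))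

countB-mono : ∀ {S S' : VSet n} → S ⊆ᵥ S' → countB S ≤ countB S'
countB-mono S⊆S' = sumF-mono-≤ (λ v → ind-mono (S⊆S' v))

countB-⊎ : ∀ {A B C : VSet n} → A ≐ B ⊎ C → countB A ≡ countB B + countB C
countB-⊎ {B = B} {C} A≐B⊎C = trans (sumF-cong (ind-+ A≐B⊎C)) (sumF-+ (λ v → ind (B v)) (λ v → ind (C v)))

countB-∪ : (S T : VSet n) → countB (S ∪ᵥ T) ≤ countB S + countB T
countB-∪ S T = ≤-trans (sumF-mono-≤ (λ v → ind-∨ (S v) (T v)))
                        (≤-reflexive (sumF-+ (λ v → ind (S v)) (λ v → ind (T v))))
  where
  ind-∨ : ∀ s t → ind (s ∨ t) ≤ ind s + ind t
  ind-∨ false t = ≤-refl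
  ind-∨ true  t = s≤s z≤n

countB-⁅⁆ : (v : Fin n) → countB ⁅ v ⁆ ≡ 1
countB-⁅⁆ = sumF-⁅⁆ (λ _ → 1)

<ᵇ≡true⇒< : ∀ m k → (m <ᵇ k) ≡ true → m <ℕ k
<ᵇ≡true⇒< m k m<k = <ᵇ⇒< m k (Equivalence.from T-≡ m<k)

<ᵇ≡false⇒≥ : ∀ m k → (m <ᵇ k) ≡ false → k ≤ m
<ᵇ≡false⇒≥ m k m≮k = ≮⇒≥ (λ m<k → subst T m≮k (<⇒<ᵇ m<k))

countPairs : (Fin n → Fin n → Bool) → ℕ
countPairs F = sumF (λ i → countB (F i))

countPairs-cong : ∀ {F F' : Fin n → Fin n → Bool} → (∀ i j → F i j ≡ F' i j) →
                  countPairs F ≡ countPairs F'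
countPairs-cong F≗F' = sumF-cong (λ i → countB-cong (F≗F' i))

countPairs-mono : ∀ {F F' : Fin n → Fin n → Bool} →
                  (∀ i j → F i j ≡ true → F' i j ≡ true) → countPairs F ≤ countPairs F'
countPairs-mono F⊆F' = sumF-mono-≤ (λ i → countB-mono (F⊆F' i))

countPairs-⊎ : ∀ {F A B : Fin n → Fin n → Bool} → (∀ i j → ind (F i j) ≡ ind (A i j) + ind (B i j)) →
               countPairs F ≡ countPairs A + countPairs B
countPairs-⊎ {A = A} {B} F≐A⊎B =
  trans (sumF-cong (λ i → countB-⊎ (record { ind-+ = F≐A⊎B i })))
        (sumF-+ (λ i → countB (A i)) (λ i → countB (B i)))

countPairs-transpose : (F : Fin n → Fin n → Bool) → countPairs F ≡ countPairs (λ i j → F j i)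
countPairs-transpose F = sumF-comm (λ i j → ind (F i j))

countPairs-false : ∀ {F : Fin n → Fin n → Bool} → (∀ i j → F i j ≡ false) → countPairs F ≡ 0
countPairs-false {n} F=∅ = trans (countPairs-cong {n} {F' = λ _ _ → false} F=∅)
  (trans (sumF-cong {n} {g = λ _ → 0} (λ _ → sumF-zero n)) (sumF-zero n))

ind-split-∧ˡ : ∀ {a b c} s → ind a ≡ ind b + ind c → ind (s ∧ a) ≡ ind (s ∧ b) + ind (s ∧ c)
ind-split-∧ˡ false _     = refl
ind-split-∧ˡ true  split = split

ind-split-∧ʳ : ∀ {a b c} t → ind a ≡ ind b + ind c → ind (a ∧ t) ≡ ind (b ∧ t) + ind (c ∧ t)
ind-split-∧ʳ {a} {b} {c} false _ rewrite ∧-zeroʳ a | ∧-zeroʳ b | ∧-zeroʳ c = refl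
ind-split-∧ʳ {a} {b} {c} true split rewrite ∧-identityʳ a | ∧-identityʳ b | ∧-identityʳ c = split

∧-mono : ∀ {a a' b b'} → (a ≡ true → a' ≡ true) → (b ≡ true → b' ≡ true) → a ∧ b ≡ true → a' ∧ b' ≡ true
∧-mono {true} {b = true} a⇒a' b⇒b' _ = cong₂ _∧_ (a⇒a' refl) (b⇒b' refl)

∧-swap : ∀ a b c → a ∧ (b ∧ c) ≡ b ∧ (a ∧ c)
∧-swap false false c = refl
∧-swap false true  c = refl
∧-swap true  false c = refl
∧-swap true  true  c = refl

module _ (X : Graph n) where

  eBetween-mono : ∀ {S S' T T'} → S ⊆ᵥ S' → T ⊆ᵥ T' → eBetween X S T ≤ eBetween X S' T'
  eBetween-mono S⊆S' T⊆T' = countPairs-mono (λ i j → ∧-mono (S⊆S' i) (∧-mono (T⊆T' j) (λ e → e)))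

  eBetween-cong : ∀ {S S' T T'} → (∀ i → S i ≡ S' i) → (∀ j → T j ≡ T' j) →
                  eBetween X S T ≡ eBetween X S' T'
  eBetween-cong S≗S' T≗T' =
    countPairs-cong (λ i j → cong₂ (λ s t → s ∧ t ∧ adj X i j) (S≗S' i) (T≗T' j))

  eBetween-comm : ∀ S T → eBetween X S T ≡ eBetween X T S
  eBetween-comm S T = trans (countPairs-transpose (λ i j → S i ∧ T j ∧ adj X i j))
    (countPairs-cong (λ i j → trans (∧-swap (S j) (T i) _)
                                     (cong (λ x → T i ∧ S j ∧ x) (Graph.sym X j i))))

  eBetween-⊎ˡ : ∀ {A B C} → A ≐ B ⊎ C → ∀ T → eBetween X A T ≡ eBetween X B T + eBetween X C T
  eBetween-⊎ˡ {A} {B} {C} A≐B⊎C T =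
    countPairs-⊎ {A = λ i j → B i ∧ T j ∧ adj X i j} {B = λ i j → C i ∧ T j ∧ adj X i j}
                 (λ i j → ind-split-∧ʳ {A i} {B i} {C i} (T j ∧ adj X i j) (ind-+ A≐B⊎C i))

  eBetween-⊎ʳ : ∀ {A B C} → A ≐ B ⊎ C → ∀ S → eBetween X S A ≡ eBetween X S B + eBetween X S C
  eBetween-⊎ʳ {A} {B} {C} A≐B⊎C S = begin
    eBetween X S A                    ≡⟨ eBetween-comm S A ⟩
    eBetween X A S                    ≡⟨ eBetween-⊎ˡ {A} {B} {C} A≐B⊎C S ⟩
    eBetween X B S + eBetween X C S   ≡⟨ cong₂ _+_ (eBetween-comm B S) (eBetween-comm C S) ⟩
    eBetween X S B + eBetween X S C   ∎
    where open ≡-Reasoning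

  eBetween-∅ˡ : ∀ {S} → (∀ v → S v ≡ false) → ∀ T → eBetween X S T ≡ 0
  eBetween-∅ˡ S=∅ T = countPairs-false (λ i j → cong (λ s → s ∧ T j ∧ adj X i j) (S=∅ i))

  volume≡eBetween-all : ∀ S → volume X S ≡ eBetween X S all
  volume≡eBetween-all S = sumF-cong (λ i → row i (S i))
    where
    row : ∀ i s → (if s then deg X i else 0) ≡ countB (λ j → s ∧ true ∧ adj X i j)
    row i false = ≡-sym (sumF-zero n)
    row i true  = refl

  volume-⁅⁆ : ∀ v → volume X ⁅ v ⁆ ≡ deg X v
  volume-⁅⁆ = sumF-⁅⁆ (deg X)

  *-countB≤volume : ∀ {S k} → (∀ v → S v ≡ true → k ≤ deg X v) → k * countB S ≤ volume X S
  *-countB≤volume {S} {k} k≤deg =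
    subst (_≤ volume X S) (sumF-const-on S k) (sumF-mono-≤ (λ v → if-mono (S v) (k≤deg v)))

  volume≤*-countB : ∀ {S k} → (∀ v → S v ≡ true → deg X v ≤ k) → volume X S ≤ k * countB S
  volume≤*-countB {S} {k} deg≤k =
    subst (volume X S ≤_) (sumF-const-on S k) (sumF-mono-≤ (λ v → if-mono (S v) (deg≤k v)))

  handshake : volume X all ≡ 2 * edgeCount X
  handshake = begin
    countPairs (adj X)                    ≡⟨ countPairs-⊎ orient ⟩
    edgeCount X + countPairs Backward     ≡⟨ cong (_+_ (edgeCount X)) backward≡edgeCount ⟩
    edgeCount X + edgeCount X             ≡⟨ cong (_+_ (edgeCount X)) (≡-sym (+-identityʳ _)) ⟩
    2 * edgeCount X                       ∎
    where
    open ≡-Reasoning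
    Backward : Fin n → Fin n → Bool
    Backward i j = (toℕ j <ᵇ toℕ i) ∧ adj X i j
    backward≡edgeCount : countPairs Backward ≡ edgeCount X
    backward≡edgeCount = trans (countPairs-transpose Backward)
      (countPairs-cong (λ i j → cong (_∧_ (toℕ i <ᵇ toℕ j)) (Graph.sym X j i)))
    orient : ∀ i j → ind (adj X i j) ≡ ind ((toℕ i <ᵇ toℕ j) ∧ adj X i j) + ind (Backward i j)
    orient i j with toℕ i <ᵇ toℕ j in i<j | toℕ j <ᵇ toℕ i in j<i
    ... | false | true  = refl
    ... | true  | false = ≡-sym (+-identityʳ _)
    ... | true  | true  = ⊥-elim (<-asym (<ᵇ≡true⇒< (toℕ i) (toℕ j) i<j) (<ᵇ≡true⇒< (toℕ j) (toℕ i) j<i))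
    ... | false | false = cong ind (subst (λ k → adj X i k ≡ false) i≡j (Graph.irrefl X i))
      where
      i≡j : i ≡ j
      i≡j = toℕ-injective (≤-antisym (<ᵇ≡false⇒≥ (toℕ j) _ j<i) (<ᵇ≡false⇒≥ (toℕ i) _ i<j))

_∖ₑ_ : Graph n → Graph n → Graph n
G ∖ₑ E = record
  { adj    = λ i j → adj G i j ∧ not (adj E i j)
  ; sym    = λ i j → cong₂ (λ g e → g ∧ not e) (Graph.sym G i j) (Graph.sym E i j)
  ; irrefl = λ i → cong (λ g → g ∧ not (adj E i i)) (Graph.irrefl G i)
  }

eBetween-∖ₑ : ∀ {G E : Graph n} → E ⊆ₑ G →
              ∀ S T → eBetween G S T ≡ eBetween (G ∖ₑ E) S T + eBetween E S T
eBetween-∖ₑ {G = G} {E} E⊆G S T =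
  countPairs-⊎ {A = λ i j → S i ∧ T j ∧ adj (G ∖ₑ E) i j} {B = λ i j → S i ∧ T j ∧ adj E i j}
    (λ i j → ind-split-∧ˡ (S i) (ind-split-∧ˡ (T j) (edge-or-removed (E⊆G i j))))
  where
  edge-or-removed : ∀ {g e} → (e ≡ true → g ≡ true) → ind g ≡ ind (g ∧ not e) + ind e
  edge-or-removed {false} {false} _   = refl
  edge-or-removed {true}  {false} _   = refl
  edge-or-removed {true}  {true}  _   = refl
  edge-or-removed {false} {true}  e⇒g with e⇒g refl
  ... | ()

_[_] : Graph n → VSet n → Graph n
X [ V ] = record
  { adj    = λ i j → V i ∧ V j ∧ adj X i j
  ; sym    = λ i j → trans (∧-swap (V i) (V j) _) (cong (λ x → V j ∧ V i ∧ x) (Graph.sym X i j))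
  ; irrefl = λ i → trans (cong (λ x → V i ∧ V i ∧ x) (Graph.irrefl X i))
                         (trans (cong (_∧_ (V i)) (∧-zeroʳ (V i))) (∧-zeroʳ (V i)))
  }

module _ (X : Graph n) {V : VSet n} where

  eBetween-induced : ∀ {S T} → S ⊆ᵥ V → T ⊆ᵥ V → eBetween (X [ V ]) S T ≡ eBetween X S T
  eBetween-induced {S} {T} S⊆V T⊆V = countPairs-cong (λ i j → drop-V (S⊆V i) (T⊆V j))
    where
    drop-V : ∀ {s t vi vj x} → (s ≡ true → vi ≡ true) → (t ≡ true → vj ≡ true) →
             s ∧ t ∧ (vi ∧ vj ∧ x) ≡ s ∧ t ∧ x
    drop-V {false}                 _    _    = refl
    drop-V {true}  {false}         _    _    = refl
    drop-V {true}  {true}  s⇒vi t⇒vj rewrite s⇒vi refl | t⇒vj refl = refl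

  volume-induced : ∀ {S} → S ⊆ᵥ V → volume (X [ V ]) S ≡ eBetween X S V
  volume-induced {S} S⊆V =
    trans (volume≡eBetween-all (X [ V ]) S)
          (countPairs-cong (λ i j → drop-V {vj = V j} {adj X i j} (S⊆V i)))
    where
    drop-V : ∀ {s vi vj x} → (s ≡ true → vi ≡ true) → s ∧ true ∧ (vi ∧ vj ∧ x) ≡ s ∧ vj ∧ x
    drop-V {false}      _    = refl
    drop-V {true}  s⇒vi rewrite s⇒vi refl = refl

∖ₑ-induced-isSubgraphMinus : (G E : Graph n) (V : VSet n) → IsSubgraphMinus G E V ((G ∖ₑ E) [ V ])
∖ₑ-induced-isSubgraphMinus G E V i j = split (V i) (V j) (adj G i j) (adj E i j)
  where
  split : ∀ vi vj g e → vi ∧ vj ∧ (g ∧ not e) ≡ true → (vi ≡ true) × (g ≡ true) × (e ≡ false)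
  split true true true false _ = refl , refl , refl

Extensional : (VSet n → ℕ) → Set
Extensional f = ∀ {S T} → (∀ v → S v ≡ T v) → f S ≡ f T

_◂_ : Bool → VSet n → VSet (suc n)
(b ◂ S) zero    = b
(b ◂ S) (suc v) = S v

minimiser : (f : VSet n → ℕ) → Extensional f → Σ (VSet n) λ U → ∀ S → f U ≤ f S
minimiser {zero}  f f-ext = (λ ()) , λ S → ≤-reflexive (f-ext (λ ()))
minimiser {suc n} f f-ext = choose (f (true ◂ U₁) ≤? f (false ◂ U₀))
  where
  restrict : ∀ b → Σ (VSet n) λ U → ∀ S → f (b ◂ U) ≤ f (b ◂ S)
  restrict b = minimiser (λ S → f (b ◂ S)) (λ S≗T → f-ext (λ { zero → refl ; (suc v) → S≗T v }))
  U₁ U₀ : VSet n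
  U₁ = proj₁ (restrict true)
  U₀ = proj₁ (restrict false)
  below : ∀ {U} → f U ≤ f (true ◂ U₁) → f U ≤ f (false ◂ U₀) → ∀ S → f U ≤ f S
  below {U} ≤U₁ ≤U₀ S = subst (f U ≤_) (f-ext (λ { zero → refl ; (suc v) → refl })) (by-head (S zero))
    where
    by-head : ∀ b → f U ≤ f (b ◂ (λ v → S (suc v)))
    by-head true  = ≤-trans ≤U₁ (proj₂ (restrict true) _)
    by-head false = ≤-trans ≤U₀ (proj₂ (restrict false) _)
  choose : Dec (f (true ◂ U₁) ≤ f (false ◂ U₀)) → Σ (VSet (suc n)) λ U → ∀ S → f U ≤ f S
  choose (yes U₁≤U₀) = true ◂ U₁ , below ≤-refl U₁≤U₀
  choose (no  U₁≰U₀) = false ◂ U₀ , below (<⇒≤ (≰⇒> U₁≰U₀)) ≤-refl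

constrained-minimiser : (f : VSet n → ℕ) (P : VSet n → Bool) → Extensional f →
  (∀ {S T} → (∀ v → S v ≡ T v) → P S ≡ P T) → ∀ S₀ → P S₀ ≡ true →
  Σ (VSet n) λ U → P U ≡ true × (∀ S → P S ≡ true → f U ≤ f S)
constrained-minimiser f P f-ext P-ext S₀ PS₀ =
  U , PU , λ S PS → subst₂ _≤_ (penalised-on PU) (penalised-on PS) (U-min S)
  where
  penalised : VSet _ → ℕ
  penalised S = if P S then f S else suc (f S₀)
  penalised-on : ∀ {S} → P S ≡ true → penalised S ≡ f S
  penalised-on PS rewrite PS = refl
  minimum : Σ (VSet _) λ U → ∀ S → penalised U ≤ penalised S
  minimum = minimiser penalised
    (λ S≗T → cong₂ (λ b x → if b then x else suc (f S₀)) (P-ext S≗T) (f-ext S≗T))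
  U = proj₁ minimum
  U-min = proj₂ minimum
  PU : P U ≡ true
  PU with P U in eq | U-min S₀
  ... | true  | _ = refl
  ... | false | U≤S₀ = ⊥-elim (<-irrefl refl (subst (suc (f S₀) ≤_) (penalised-on PS₀) U≤S₀))

-- mkℚᵘ (+ a) b denotes a / (1 + b).
toℚᵘ-ℕ→ℚ : ∀ x → toℚᵘ (ℕ→ℚ x) ≃ mkℚᵘ (+ x) 0
toℚᵘ-ℕ→ℚ x = ℚᵘₚ.≃-reflexive (cong toℚᵘ (ℚₚ.normalize-coprime (Coprimality.sym (1-coprimeTo x))))

toℚᵘ-* : ∀ r s {a b c d} → toℚᵘ r ≃ mkℚᵘ (+ a) b → toℚᵘ s ≃ mkℚᵘ (+ c) d →
         toℚᵘ (r Q.* s) ≃ mkℚᵘ (+ (a * c)) (d + b * suc d)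
toℚᵘ-* r s {a} {b} {c} {d} r≃a/b s≃c/d =
  ℚᵘₚ.≃-trans (ℚₚ.toℚᵘ-homo-* r s)
    (ℚᵘₚ.≃-trans (ℚᵘₚ.*-cong r≃a/b s≃c/d)
      (ℚᵘₚ.≃-reflexive (cong (λ z → mkℚᵘ z (d + b * suc d)) (≡-sym (ℤₚ.pos-* a c)))))

≤⇒cross-≤ : ∀ {r s a b c d} → toℚᵘ r ≃ mkℚᵘ (+ a) b → toℚᵘ s ≃ mkℚᵘ (+ c) d →
            r Q.≤ s → a * suc d ≤ c * suc b
≤⇒cross-≤ {a = a} {b} {c} {d} r≃a/b s≃c/d r≤s =
  ℤₚ.drop‿+≤+ (subst₂ ℤ._≤_ (≡-sym (ℤₚ.pos-* a (suc d))) (≡-sym (ℤₚ.pos-* c (suc b)))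
    (ℚᵘₚ.drop-*≤* (ℚᵘₚ.≤-respʳ-≃ s≃c/d (ℚᵘₚ.≤-respˡ-≃ r≃a/b (ℚₚ.toℚᵘ-mono-≤ r≤s)))))

cross-≤⇒≤ : ∀ {r s a b c d} → toℚᵘ r ≃ mkℚᵘ (+ a) b → toℚᵘ s ≃ mkℚᵘ (+ c) d →
            a * suc d ≤ c * suc b → r Q.≤ s
cross-≤⇒≤ {a = a} {b} {c} {d} r≃a/b s≃c/d ad≤cb =
  ℚₚ.toℚᵘ-cancel-≤ (ℚᵘₚ.≤-respʳ-≃ (ℚᵘₚ.≃-sym s≃c/d) (ℚᵘₚ.≤-respˡ-≃ (ℚᵘₚ.≃-sym r≃a/b)
    (*≤* (subst₂ ℤ._≤_ (ℤₚ.pos-* a (suc d)) (ℤₚ.pos-* c (suc b)) (+≤+ ad≤cb)))))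

Expands : ℕ → ℕ → VSet n → Graph n → Set
Expands p q V G = ∀ S → S ⊆ᵥ V → NonEmpty S → 2 * countB S ≤ countB V →
                  p * volume G S ≤ q * eBetween G S (V ∖ S)

module _ {p d : ℕ} .{cp : Coprime p (suc d)} where

  mkℚ-*-ℕ→ℚ-≤⇒ : ∀ x y → mkℚ (+ p) d cp Q.* ℕ→ℚ x Q.≤ ℕ→ℚ y → p * x ≤ suc d * y
  mkℚ-*-ℕ→ℚ-≤⇒ x y c*x≤y = begin
    p * x                  ≡⟨ solve (p ∷ x ∷ []) ⟩
    p * x * 1              ≤⟨ ≤⇒cross-≤ (toℚᵘ-* (mkℚ (+ p) d cp) (ℕ→ℚ x) ℚᵘₚ.≃-refl (toℚᵘ-ℕ→ℚ x))
                                        (toℚᵘ-ℕ→ℚ y) c*x≤y ⟩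
    y * suc (d * 1)        ≡⟨ solve (y ∷ d ∷ []) ⟩
    suc d * y              ∎
    where open ≤-Reasoning

  ≤⇒mkℚ-*-tenth-*-ℕ→ℚ-≤ : ∀ x y → p * x ≤ 10 * suc d * y →
                          mkℚ (+ p) d cp Q.* ((+ 1) / 10) Q.* ℕ→ℚ x Q.≤ ℕ→ℚ y
  ≤⇒mkℚ-*-tenth-*-ℕ→ℚ-≤ x y px≤10qy =
    cross-≤⇒≤ (toℚᵘ-* _ (ℕ→ℚ x) (toℚᵘ-* (mkℚ (+ p) d cp) ((+ 1) / 10) ℚᵘₚ.≃-refl tenth) (toℚᵘ-ℕ→ℚ x))
              (toℚᵘ-ℕ→ℚ y) (begin
      p * 1 * x * 1                    ≡⟨ solve (p ∷ x ∷ []) ⟩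
      p * x                            ≤⟨ px≤10qy ⟩
      10 * suc d * y                   ≡⟨ solve (y ∷ d ∷ []) ⟩
      y * suc ((9 + d * 10) * 1)       ∎)
    where
    open ≤-Reasoning
    tenth : toℚᵘ ((+ 1) / 10) ≃ mkℚᵘ (+ 1) 9
    tenth = ℚᵘₚ.≃-reflexive (cong toℚᵘ (ℚₚ.normalize-coprime (1-coprimeTo 10)))

  isExpanderOn⇒Expands : ∀ {V} {G : Graph n} → IsExpanderOn (mkℚ (+ p) d cp) V G → Expands p (suc d) V G
  isExpanderOn⇒Expands expander S S⊆V S≢∅ half = mkℚ-*-ℕ→ℚ-≤⇒ _ _ (expander S S⊆V S≢∅ half)

  expands⇒isExpanderOn : ∀ {V} {G : Graph n} → Expands p (10 * suc d) V G →
                         IsExpanderOn (mkℚ (+ p) d cp Q.* ((+ 1) / 10)) V G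
  expands⇒isExpanderOn expands S S⊆V S≢∅ half = ≤⇒mkℚ-*-tenth-*-ℕ→ℚ-≤ _ _ (expands S S⊆V S≢∅ half)

  mkℚ≤1⇒≤ : mkℚ (+ p) d cp Q.≤ Q.1ℚ → p ≤ suc d
  mkℚ≤1⇒≤ c≤1 = subst₂ _≤_ (*-identityʳ p) (*-identityˡ (suc d)) (≤⇒cross-≤ ℚᵘₚ.≃-refl ℚᵘₚ.≃-refl c≤1)

  ℕ→ℚ-*-≤-mkℚ-* : ∀ m k N → ℕ→ℚ m Q.* ℕ→ℚ k Q.≤ mkℚ (+ p) d cp Q.* ℕ→ℚ N → suc d * (k * m) ≤ p * N
  ℕ→ℚ-*-≤-mkℚ-* m k N hyp = begin
    suc d * (k * m)               ≡⟨ solve (k ∷ m ∷ d ∷ []) ⟩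
    m * k * suc (d * 1)           ≤⟨ ≤⇒cross-≤ (toℚᵘ-* (ℕ→ℚ m) (ℕ→ℚ k) (toℚᵘ-ℕ→ℚ m) (toℚᵘ-ℕ→ℚ k))
                                       (toℚᵘ-* (mkℚ (+ p) d cp) (ℕ→ℚ N) ℚᵘₚ.≃-refl (toℚᵘ-ℕ→ℚ N)) hyp ⟩
    p * N * 1                     ≡⟨ *-identityʳ (p * N) ⟩
    p * N                         ∎
    where open ≤-Reasoning

module Deletion
  {N p q : ℕ} .{{_ : NonZero p}} .{{_ : NonZero q}} (p≤q : p ≤ q)
  (G E : Graph N) (E⊆G : E ⊆ₑ G) (E≢∅ : 1 ≤ edgeCount E)
  (E-sparse : q * (100 * edgeCount E) ≤ p * N)
  (G-expands : Expands p q all G) (G-deg≥3 : MinDegOn≥ all G 3)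
  where

  H : Graph N
  H = G ∖ₑ E

  eH : VSet N → VSet N → ℕ
  eH = eBetween H

  dH dE dG : VSet N → ℕ
  dH S = eBetween H S all
  dE S = eBetween E S all
  dG S = eBetween G S all

  M : ℕ
  M = dE all

  eG≡eH+eE : ∀ S T → eBetween G S T ≡ eH S T + eBetween E S T
  eG≡eH+eE = eBetween-∖ₑ {G = G} {E} E⊆G

  dH≤dG : ∀ S → dH S ≤ dG S
  dH≤dG S = ≤-trans (m≤m+n (dH S) (dE S)) (≤-reflexive (≡-sym (eG≡eH+eE S all)))

  eE≤M : ∀ S T → eBetween E S T ≤ M
  eE≤M S T = eBetween-mono E (⊆all S) (⊆all T)

  3*countB≤dG : ∀ S → 3 * countB S ≤ dG S
  3*countB≤dG S =
    ≤-trans (*-countB≤volume G {S} {3} (λ v _ → G-deg≥3 v refl)) (≤-reflexive (volume≡eBetween-all G S))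

  E-tiny : 100 * edgeCount E ≤ N
  E-tiny = *-cancelˡ-≤ q (≤-trans E-sparse (*-monoˡ-≤ N p≤q))

  N≥100 : 100 ≤ N
  N≥100 = ≤-trans (*-monoʳ-≤ 100 E≢∅) E-tiny

  50*M≡100*edgeCount : 50 * M ≡ 100 * edgeCount E
  50*M≡100*edgeCount = begin
    50 * M                         ≡⟨ cong (_*_ 50) (≡-sym (volume≡eBetween-all E all)) ⟩
    50 * volume E all              ≡⟨ cong (_*_ 50) (handshake E) ⟩
    50 * (2 * edgeCount E)         ≡⟨ ≡-sym (*-assoc 50 2 (edgeCount E)) ⟩
    100 * edgeCount E              ∎
    where open ≡-Reasoning

  M-tiny : 50 * M ≤ N
  M-tiny = subst (_≤ N) (≡-sym 50*M≡100*edgeCount) E-tiny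

  qM-sparse : q * (50 * M) ≤ p * N
  qM-sparse = subst (λ x → q * x ≤ p * N) (≡-sym 50*M≡100*edgeCount) E-sparse

  G-expansion : ∀ {S} → NonEmpty S → 2 * countB S ≤ N → p * dG S ≤ q * eBetween G S (∁ S)
  G-expansion {S} S≢∅ half = begin
    p * dG S               ≡⟨ cong (_*_ p) (≡-sym (volume≡eBetween-all G S)) ⟩
    p * volume G S         ≤⟨ G-expands S (⊆all S) S≢∅ (≤-trans half (≤-reflexive (≡-sym (countB-all N)))) ⟩
    q * eBetween G S (∁ S) ∎
    where open ≤-Reasoning

  Φ : VSet N → ℕ
  Φ W = p * dH W + 10 * q * dE W

  Ψ : VSet N → ℕ
  Ψ U = 10 * q * eH U (∁ U) + Φ (∁ U)

  Φ-cong : ∀ {A B} → (∀ v → A v ≡ B v) → Φ A ≡ Φ B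
  Φ-cong A≗B = cong₂ (λ x y → p * x + 10 * q * y)
    (eBetween-cong H {T = all} {all} A≗B (λ _ → refl))
    (eBetween-cong E {T = all} {all} A≗B (λ _ → refl))

  Φ-⊎ : ∀ {A B C} → A ≐ B ⊎ C → Φ A ≡ Φ B + Φ C
  Φ-⊎ {A} {B} {C} A≐B⊎C = begin
    p * dH A + 10 * q * dE A
      ≡⟨ cong₂ (λ x y → p * x + 10 * q * y) (eBetween-⊎ˡ H A≐B⊎C all) (eBetween-⊎ˡ E A≐B⊎C all) ⟩
    p * (dH B + dH C) + 10 * q * (dE B + dE C)
      ≡⟨ cong₂ _+_ (*-distribˡ-+ p (dH B) (dH C)) (*-distribˡ-+ (10 * q) (dE B) (dE C)) ⟩
    (p * dH B + p * dH C) + (10 * q * dE B + 10 * q * dE C)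
      ≡⟨ interchange (p * dH B) (p * dH C) (10 * q * dE B) (10 * q * dE C) ⟩
    Φ B + Φ C ∎
    where open ≡-Reasoning

  Ψ-ext : Extensional Ψ
  Ψ-ext S≗T = cong₂ (λ x y → 10 * q * x + y)
    (eBetween-cong H S≗T (λ v → cong not (S≗T v))) (Φ-cong (λ v → cong not (S≗T v)))

  half? : VSet N → Bool
  half? S = 2 * countB S ≤ᵇ N

  half?⇒ : ∀ {S} → half? S ≡ true → 2 * countB S ≤ N
  half?⇒ h = ≤ᵇ⇒≤ _ N (Equivalence.from T-≡ h)

  ⇒half? : ∀ {S} → 2 * countB S ≤ N → half? S ≡ true
  ⇒half? h = Equivalence.to T-≡ (≤⇒≤ᵇ h)

  ∅-half : 2 * countB {N} ∅ᵥ ≤ N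
  ∅-half = subst (λ k → 2 * k ≤ N) (≡-sym (sumF-zero N)) z≤n

  minimum : Σ (VSet N) λ U → half? U ≡ true × (∀ S → half? S ≡ true → Ψ U ≤ Ψ S)
  minimum = constrained-minimiser Ψ half? Ψ-ext (λ S≗T → cong (λ k → 2 * k ≤ᵇ N) (countB-cong S≗T))
                                  ∅ᵥ (⇒half? ∅-half)

  U V : VSet N
  U = proj₁ minimum
  V = ∁ U

  G' : Graph N
  G' = H [ V ]

  U-half : 2 * countB U ≤ N
  U-half = half?⇒ (proj₁ (proj₂ minimum))

  Ψ-minimal : ∀ S → 2 * countB S ≤ N → Ψ U ≤ Ψ S
  Ψ-minimal S half = proj₂ (proj₂ minimum) S (⇒half? half)

  cut-bound : 10 * q * eH U V ≤ p * dG U + 10 * q * M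
  cut-bound = ≤-trans (+-cancelʳ-≤ (Φ V) _ _ (begin
    10 * q * eH U V + Φ V     ≤⟨ Ψ-minimal ∅ᵥ ∅-half ⟩
    Ψ ∅ᵥ                      ≡⟨ cong₂ _+_ ∅-boundary (Φ-⊎ (all≐⊎∁ U)) ⟩
    Φ U + Φ V                 ∎))
    (+-mono-≤ (*-monoʳ-≤ p (dH≤dG U)) (*-monoʳ-≤ (10 * q) (eE≤M U all)))
    where
    open ≤-Reasoning
    ∅-boundary : 10 * q * eH ∅ᵥ all ≡ 0
    ∅-boundary = trans (cong (_*_ (10 * q)) (eBetween-∅ˡ H (λ _ → refl) all)) (*-zeroʳ (10 * q))

  extension-bound : ∀ {S} → S ⊆ᵥ V → 2 * countB (U ∪ᵥ S) ≤ N →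
                    10 * q * eH U S + Φ S ≤ 10 * q * eH S (V ∖ S)
  extension-bound {S} S⊆V half = +-cancelʳ-≤ (10 * q * eH U (V ∖ S) + Φ (V ∖ S)) _ _ (begin
    (10 * q * eH U S + Φ S) + (10 * q * eH U (V ∖ S) + Φ (V ∖ S))
      ≡⟨ regroupˡ (10 * q) (eH U S) (eH U (V ∖ S)) (Φ S) (Φ (V ∖ S)) ⟩
    10 * q * (eH U S + eH U (V ∖ S)) + (Φ S + Φ (V ∖ S))
      ≡⟨ ≡-sym (cong₂ (λ x y → 10 * q * x + y) (eBetween-⊎ʳ H V≐S⊎V∖S U) (Φ-⊎ V≐S⊎V∖S)) ⟩
    Ψ U
      ≤⟨ Ψ-minimal (U ∪ᵥ S) half ⟩
    Ψ (U ∪ᵥ S)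
      ≡⟨ cong₂ (λ x y → 10 * q * x + y) ∪-boundary (Φ-cong (∁-∪ U S)) ⟩
    10 * q * (eH U (V ∖ S) + eH S (V ∖ S)) + Φ (V ∖ S)
      ≡⟨ regroupʳ (10 * q) (eH U (V ∖ S)) (eH S (V ∖ S)) (Φ (V ∖ S)) ⟩
    10 * q * eH S (V ∖ S) + (10 * q * eH U (V ∖ S) + Φ (V ∖ S)) ∎)
    where
    open ≤-Reasoning
    V≐S⊎V∖S : V ≐ S ⊎ (V ∖ S)
    V≐S⊎V∖S = ⊆⇒≐⊎∖ S⊆V
    ∪-boundary : eH (U ∪ᵥ S) (∁ (U ∪ᵥ S)) ≡ eH U (V ∖ S) + eH S (V ∖ S)
    ∪-boundary = trans (eBetween-cong H {U ∪ᵥ S} {U ∪ᵥ S} (λ _ → refl) (∁-∪ U S))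
                       (eBetween-⊎ˡ H (⊆∁⇒∪≐⊎ S⊆V) (V ∖ S))
    regroupˡ : ∀ k a b c d → (k * a + c) + (k * b + d) ≡ k * (a + b) + (c + d)
    regroupˡ k a b c d = solve (k ∷ a ∷ b ∷ c ∷ d ∷ [])
    regroupʳ : ∀ k a g d → k * (a + g) + d ≡ k * g + (k * a + d)
    regroupʳ k a g d = solve (k ∷ a ∷ g ∷ d ∷ [])

  U-expansion : p * dG U ≤ q * (eH U V + M)
  U-expansion with nonEmpty? U
  ... | no U=∅ =
    ≤-trans (≤-reflexive (trans (cong (_*_ p) (eBetween-∅ˡ G (¬NonEmpty⇒∅ U=∅) all)) (*-zeroʳ p))) z≤n
  ... | yes U≢∅ = begin
    p * dG U                        ≤⟨ G-expansion U≢∅ U-half ⟩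
    q * eBetween G U V              ≡⟨ cong (_*_ q) (eG≡eH+eE U V) ⟩
    q * (eH U V + eBetween E U V)   ≤⟨ *-monoʳ-≤ q (+-monoʳ-≤ (eH U V) (eE≤M U V)) ⟩
    q * (eH U V + M)                ∎
    where open ≤-Reasoning

  U-volume-bound : 9 * p * dG U ≤ 20 * q * M
  U-volume-bound = arithmetic (dG U) (eH U V) M U-expansion cut-bound
    where
    arithmetic : ∀ x a m → p * x ≤ q * (a + m) → 10 * q * a ≤ p * x + 10 * q * m → 9 * p * x ≤ 20 * q * m
    arithmetic x a m px≤q[a+m] cut = +-cancelˡ-≤ (p * x) _ _ (begin
      p * x + 9 * p * x                  ≡⟨ solve (p ∷ x ∷ []) ⟩
      10 * (p * x)                       ≤⟨ *-monoʳ-≤ 10 px≤q[a+m] ⟩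
      10 * (q * (a + m))                 ≡⟨ solve (q ∷ a ∷ m ∷ []) ⟩
      10 * q * a + 10 * q * m            ≤⟨ +-monoˡ-≤ (10 * q * m) cut ⟩
      p * x + 10 * q * m + 10 * q * m    ≡⟨ solve (p ∷ x ∷ q ∷ m ∷ []) ⟩
      p * x + 20 * q * m                 ∎)
      where open ≤-Reasoning

  cut-small : 9 * eH U V ≤ 11 * M
  cut-small = arithmetic (eH U V) (dG U) M cut-bound U-volume-bound
    where
    arithmetic : ∀ a x m → 10 * q * a ≤ p * x + 10 * q * m → 9 * p * x ≤ 20 * q * m → 9 * a ≤ 11 * m
    arithmetic a x m cut x-bound = *-cancelˡ-≤ (10 * q) {{m*n≢0 10 q}} (begin
      10 * q * (9 * a)              ≡⟨ solve (q ∷ a ∷ []) ⟩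
      9 * (10 * q * a)              ≤⟨ *-monoʳ-≤ 9 cut ⟩
      9 * (p * x + 10 * q * m)      ≡⟨ solve (p ∷ x ∷ q ∷ m ∷ []) ⟩
      9 * p * x + 90 * q * m        ≤⟨ +-monoˡ-≤ (90 * q * m) x-bound ⟩
      20 * q * m + 90 * q * m       ≡⟨ solve (q ∷ m ∷ []) ⟩
      10 * q * (11 * m)             ∎)
      where open ≤-Reasoning

  U-small : 135 * countB U ≤ 2 * N
  U-small = arithmetic (countB U) (dG U) M (3*countB≤dG U) U-volume-bound qM-sparse
    where
    arithmetic : ∀ u x m → 3 * u ≤ x → 9 * p * x ≤ 20 * q * m → q * (50 * m) ≤ p * N → 135 * u ≤ 2 * N
    arithmetic u x m 3u≤x x-bound m-bound = begin
      135 * u       ≡⟨ solve (u ∷ []) ⟩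
      45 * (3 * u)  ≤⟨ *-monoʳ-≤ 45 3u≤x ⟩
      45 * x        ≤⟨ *-cancelˡ-≤ p (begin
        p * (45 * x)            ≡⟨ solve (p ∷ x ∷ []) ⟩
        5 * (9 * p * x)         ≤⟨ *-monoʳ-≤ 5 x-bound ⟩
        5 * (20 * q * m)        ≡⟨ solve (q ∷ m ∷ []) ⟩
        2 * (q * (50 * m))      ≤⟨ *-monoʳ-≤ 2 m-bound ⟩
        2 * (p * N)             ≡⟨ solve (p ∷ N ∷ []) ⟩
        p * (2 * N)             ∎) ⟩
      2 * N         ∎
      where open ≤-Reasoning

  U∪S-half : ∀ S → 60 * countB S ≤ N → 2 * countB (U ∪ᵥ S) ≤ N
  U∪S-half S S-small =
    ≤-trans (*-monoʳ-≤ 2 (countB-∪ U S)) (arithmetic (countB U) (countB S) U-small S-small)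
    where
    arithmetic : ∀ u s → 135 * u ≤ 2 * N → 60 * s ≤ N → 2 * (u + s) ≤ N
    arithmetic u s u-small s-small = *-cancelˡ-≤ 270 (begin
      270 * (2 * (u + s))           ≡⟨ solve (u ∷ s ∷ []) ⟩
      4 * (135 * u) + 9 * (60 * s)  ≤⟨ +-mono-≤ (*-monoʳ-≤ 4 u-small) (*-monoʳ-≤ 9 s-small) ⟩
      4 * (2 * N) + 9 * N           ≤⟨ m≤m+n (4 * (2 * N) + 9 * N) (253 * N) ⟩
      4 * (2 * N) + 9 * N + 253 * N ≡⟨ solve (N ∷ []) ⟩
      270 * N                       ∎)
      where open ≤-Reasoning

  countB-V≤N : countB V ≤ N
  countB-V≤N = ≤-trans (countB-mono {S = V} {all} (⊆all V)) (≤-reflexive (countB-all N))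

  dG-decomposition : ∀ {S} → S ⊆ᵥ V → dG S ≡ eH U S + volume G' S + dE S
  dG-decomposition {S} S⊆V = begin
    dG S                        ≡⟨ eG≡eH+eE S all ⟩
    dH S + dE S                 ≡⟨ cong (λ x → x + dE S) (eBetween-⊎ʳ H (all≐⊎∁ U) S) ⟩
    eH S U + eH S V + dE S
      ≡⟨ cong₂ (λ x y → x + y + dE S) (eBetween-comm H S U) (≡-sym (volume-induced H S⊆V)) ⟩
    eH U S + volume G' S + dE S ∎
    where open ≡-Reasoning

  volume-G'≤dH : ∀ {S} → S ⊆ᵥ V → volume G' S ≤ dH S
  volume-G'≤dH {S} S⊆V =
    ≤-trans (≤-reflexive (volume-induced H S⊆V)) (eBetween-mono H (⊆ᵥ-refl S) (⊆all V))

  large-set-bound : ∀ {S} → S ⊆ᵥ V → NonEmpty S → 2 * countB S ≤ N → 5 * q * M ≤ 2 * p * dG S →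
                    p * dG S ≤ 10 * q * eH S (V ∖ S)
  large-set-bound {S} S⊆V S≢∅ half large =
    arithmetic (dG S) (eH S (V ∖ S)) (eH U V) M S-expansion cut-small large
    where
    open ≤-Reasoning
    S-expansion : p * dG S ≤ q * (eH S (V ∖ S) + eH U V + M)
    S-expansion = begin
      p * dG S                  ≤⟨ G-expansion S≢∅ half ⟩
      q * eBetween G S (∁ S)    ≡⟨ cong (_*_ q) (eG≡eH+eE S (∁ S)) ⟩
      q * (eH S (∁ S) + eBetween E S (∁ S))
        ≡⟨ cong (λ x → q * (x + eBetween E S (∁ S))) (eBetween-⊎ʳ H (⊆∁⇒∁≐⊎∖ S⊆V) S) ⟩
      q * (eH S U + eH S (V ∖ S) + eBetween E S (∁ S))
        ≤⟨ *-monoʳ-≤ q (+-mono-≤ (≤-reflexive (+-comm (eH S U) _)) (eE≤M S (∁ S))) ⟩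
      q * (eH S (V ∖ S) + eH S U + M)
        ≤⟨ *-monoʳ-≤ q (+-monoˡ-≤ M (+-monoʳ-≤ (eH S (V ∖ S)) S-to-U)) ⟩
      q * (eH S (V ∖ S) + eH U V + M) ∎
      where
      S-to-U : eH S U ≤ eH U V
      S-to-U = ≤-trans (eBetween-mono H S⊆V (⊆ᵥ-refl U)) (≤-reflexive (eBetween-comm H V U))
    arithmetic : ∀ x g a m → p * x ≤ q * (g + a + m) → 9 * a ≤ 11 * m → 5 * q * m ≤ 2 * p * x →
                 p * x ≤ 10 * q * g
    arithmetic x g a m px-bound a-bound large =
      ≤-trans (*-cancelˡ-≤ 10 (+-cancelʳ-≤ (80 * (p * x)) _ _ (begin
      10 * (p * x) + 80 * (p * x)                  ≡⟨ solve (p ∷ x ∷ []) ⟩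
      90 * (p * x)                                 ≤⟨ *-monoʳ-≤ 90 px-bound ⟩
      90 * (q * (g + a + m))                       ≡⟨ solve (q ∷ g ∷ a ∷ m ∷ []) ⟩
      90 * q * g + 10 * q * (9 * a) + 90 * q * m
        ≤⟨ +-monoˡ-≤ (90 * q * m) (+-monoʳ-≤ (90 * q * g) (*-monoʳ-≤ (10 * q) a-bound)) ⟩
      90 * q * g + 10 * q * (11 * m) + 90 * q * m  ≡⟨ solve (q ∷ g ∷ m ∷ []) ⟩
      10 * (9 * q * g) + 40 * (5 * q * m)          ≤⟨ +-monoʳ-≤ (10 * (9 * q * g)) (*-monoʳ-≤ 40 large) ⟩
      10 * (9 * q * g) + 40 * (2 * p * x)          ≡⟨ solve (q ∷ g ∷ p ∷ x ∷ []) ⟩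
      10 * (9 * q * g) + 80 * (p * x)              ∎)))
      (*-monoˡ-≤ g (*-monoˡ-≤ q (m≤m+n 9 1)))

  small-set-bound : ∀ {S} → S ⊆ᵥ V → 2 * p * dG S ≤ 5 * q * M → p * dH S ≤ 10 * q * eH S (V ∖ S)
  small-set-bound {S} S⊆V small = begin
    p * dH S                              ≤⟨ m≤n+m (p * dH S) (10 * q * eH U S) ⟩
    10 * q * eH U S + p * dH S
      ≤⟨ +-monoʳ-≤ (10 * q * eH U S) (m≤m+n (p * dH S) (10 * q * dE S)) ⟩
    10 * q * eH U S + Φ S                 ≤⟨ extension-bound S⊆V (U∪S-half S S-small) ⟩
    10 * q * eH S (V ∖ S)                 ∎
    where
    open ≤-Reasoning
    arithmetic : ∀ s x m → 3 * s ≤ x → 2 * p * x ≤ 5 * q * m → q * (50 * m) ≤ p * N → 60 * s ≤ N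
    arithmetic s x m 3s≤x x-small m-bound = begin
      60 * s        ≡⟨ solve (s ∷ []) ⟩
      20 * (3 * s)  ≤⟨ *-monoʳ-≤ 20 3s≤x ⟩
      20 * x        ≤⟨ *-cancelˡ-≤ p (begin
        p * (20 * x)         ≡⟨ solve (p ∷ x ∷ []) ⟩
        10 * (2 * p * x)     ≤⟨ *-monoʳ-≤ 10 x-small ⟩
        10 * (5 * q * m)     ≡⟨ solve (q ∷ m ∷ []) ⟩
        q * (50 * m)         ≤⟨ m-bound ⟩
        p * N                ∎) ⟩
      N             ∎
    S-small : 60 * countB S ≤ N
    S-small = arithmetic (countB S) (dG S) M (3*countB≤dG S) small qM-sparse

  G'-expands : Expands p (10 * q) V G'
  G'-expands S S⊆V S≢∅ half = begin
    p * volume G' S                   ≤⟨ *-monoʳ-≤ p (volume-G'≤dH S⊆V) ⟩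
    p * dH S                          ≤⟨ dH-bound ⟩
    10 * q * eH S (V ∖ S)             ≡⟨ cong (_*_ (10 * q)) (≡-sym (eBetween-induced H S⊆V (∖⊆ V S))) ⟩
    10 * q * eBetween G' S (V ∖ S)    ∎
    where
    open ≤-Reasoning
    dH-bound : p * dH S ≤ 10 * q * eH S (V ∖ S)
    dH-bound with 5 * q * M ≤? 2 * p * dG S
    ... | yes large = ≤-trans (*-monoʳ-≤ p (dH≤dG S))
                              (large-set-bound S⊆V S≢∅ (≤-trans half countB-V≤N) large)
    ... | no  small = small-set-bound S⊆V (<⇒≤ (≰⇒> small))

  G'-min-degree : MinDegOn≥ V G' 2
  G'-min-degree v Vv = arithmetic (eH U ⁅ v ⁆) (deg G' v) (dE ⁅ v ⁆) three≤ lost≤kept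
    where
    open ≤-Reasoning
    v∈V : ⁅ v ⁆ ⊆ᵥ V
    v∈V = ⁅⁆⊆ Vv
    three≤ : 3 ≤ eH U ⁅ v ⁆ + deg G' v + dE ⁅ v ⁆
    three≤ = begin
      3                                          ≤⟨ G-deg≥3 v refl ⟩
      deg G v                                    ≡⟨ ≡-sym (volume-⁅⁆ G v) ⟩
      volume G ⁅ v ⁆                             ≡⟨ volume≡eBetween-all G ⁅ v ⁆ ⟩
      dG ⁅ v ⁆                                   ≡⟨ dG-decomposition v∈V ⟩
      eH U ⁅ v ⁆ + volume G' ⁅ v ⁆ + dE ⁅ v ⁆
        ≡⟨ cong (λ x → eH U ⁅ v ⁆ + x + dE ⁅ v ⁆) (volume-⁅⁆ G' v) ⟩
      eH U ⁅ v ⁆ + deg G' v + dE ⁅ v ⁆           ∎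
    v-half : 2 * countB (U ∪ᵥ ⁅ v ⁆) ≤ N
    v-half = U∪S-half ⁅ v ⁆
      (subst (λ c → 60 * c ≤ N) (≡-sym (countB-⁅⁆ v)) (≤-trans (m≤m+n 60 40) N≥100))
    lost≤kept : eH U ⁅ v ⁆ + dE ⁅ v ⁆ ≤ deg G' v
    lost≤kept = *-cancelˡ-≤ (10 * q) {{m*n≢0 10 q}} (begin
      10 * q * (eH U ⁅ v ⁆ + dE ⁅ v ⁆)            ≡⟨ *-distribˡ-+ (10 * q) (eH U ⁅ v ⁆) (dE ⁅ v ⁆) ⟩
      10 * q * eH U ⁅ v ⁆ + 10 * q * dE ⁅ v ⁆
        ≤⟨ +-monoʳ-≤ (10 * q * eH U ⁅ v ⁆) (m≤n+m (10 * q * dE ⁅ v ⁆) (p * dH ⁅ v ⁆)) ⟩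
      10 * q * eH U ⁅ v ⁆ + Φ ⁅ v ⁆               ≤⟨ extension-bound v∈V v-half ⟩
      10 * q * eH ⁅ v ⁆ (V ∖ ⁅ v ⁆)
        ≤⟨ *-monoʳ-≤ (10 * q) (eBetween-mono H (⊆ᵥ-refl ⁅ v ⁆) (∖⊆ V ⁅ v ⁆)) ⟩
      10 * q * eH ⁅ v ⁆ V
        ≡⟨ cong (_*_ (10 * q)) (trans (≡-sym (volume-induced H v∈V)) (volume-⁅⁆ G' v)) ⟩
      10 * q * deg G' v                           ∎)
    arithmetic : ∀ a d e → 3 ≤ a + d + e → a + e ≤ d → 2 ≤ d
    arithmetic a d e three≤ a+e≤d = half-of-three d (begin
      3            ≤⟨ three≤ ⟩
      a + d + e    ≡⟨ solve (a ∷ d ∷ e ∷ []) ⟩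
      d + (a + e)  ≤⟨ +-monoʳ-≤ d a+e≤d ⟩
      d + d        ∎)
      where
      half-of-three : ∀ d → 3 ≤ d + d → 2 ≤ d
      half-of-three (suc (suc d)) _ = s≤s (s≤s z≤n)
      half-of-three 1 (s≤s (s≤s ()))

  Deg≥3 : VSet N
  Deg≥3 v = 3 ≤ᵇ deg G' v

  Good Bad : VSet N
  Good v = V v ∧ Deg≥3 v
  Bad = V ∖ Deg≥3

  Bad-bound : countB Bad ≤ eH U V + M
  Bad-bound = arithmetic (countB Bad) (eH U Bad) (volume G' Bad) (dE Bad) (eH U V) M
    (begin
      3 * countB Bad                              ≤⟨ 3*countB≤dG Bad ⟩
      dG Bad                                      ≡⟨ dG-decomposition Bad⊆V ⟩
      eH U Bad + volume G' Bad + dE Bad           ∎)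
    (volume≤*-countB G' Bad-deg≤2)
    (eBetween-mono H (⊆ᵥ-refl U) Bad⊆V)
    (eE≤M Bad all)
    where
    open ≤-Reasoning
    Bad⊆V : Bad ⊆ᵥ V
    Bad⊆V = ∖⊆ V Deg≥3
    Bad-deg≤2 : ∀ v → Bad v ≡ true → deg G' v ≤ 2
    Bad-deg≤2 v Bad-v with V v | Deg≥3 v in deg≥3
    ... | true | false = ≤-pred (≰⇒> (λ 3≤deg → subst T deg≥3 (≤⇒≤ᵇ 3≤deg)))
    arithmetic : ∀ b a w e a' m → 3 * b ≤ a + w + e → w ≤ 2 * b → a ≤ a' → e ≤ m → b ≤ a' + m
    arithmetic b a w e a' m 3b≤ w≤2b a≤a' e≤m = +-cancelˡ-≤ (2 * b) _ _ (begin
      2 * b + b         ≡⟨ solve (b ∷ []) ⟩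
      3 * b             ≤⟨ 3b≤ ⟩
      a + w + e         ≤⟨ +-mono-≤ (+-mono-≤ a≤a' w≤2b) e≤m ⟩
      a' + 2 * b + m    ≡⟨ solve (a' ∷ b ∷ m ∷ []) ⟩
      2 * b + (a' + m)  ∎)

  U+V≡N : countB U + countB V ≡ N
  U+V≡N = trans (≡-sym (countB-⊎ (all≐⊎∁ U))) (countB-all N)

  V-large : N ≤ 2 * countB V
  V-large = arithmetic (countB U) (countB V) U+V≡N U-half
    where
    open ≤-Reasoning
    arithmetic : ∀ u v → u + v ≡ N → 2 * u ≤ N → N ≤ 2 * v
    arithmetic u v u+v≡N 2u≤N = +-cancelˡ-≤ N _ _ (begin
      N + N              ≡⟨ cong₂ _+_ (≡-sym u+v≡N) (≡-sym u+v≡N) ⟩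
      (u + v) + (u + v)  ≡⟨ solve (u ∷ v ∷ []) ⟩
      2 * u + 2 * v      ≤⟨ +-monoˡ-≤ (2 * v) 2u≤N ⟩
      N + 2 * v          ∎)

  Good-large : N ≤ 4 * countB Good
  Good-large = arithmetic (countB U) (countB Good) (countB Bad) (eH U V) M
    (trans (cong (_+_ (countB U)) (≡-sym (countB-⊎ (≐-split V Deg≥3)))) U+V≡N)
    U-half Bad-bound cut-small M-tiny
    where
    open ≤-Reasoning
    arithmetic : ∀ u g b a m → u + (g + b) ≡ N → 2 * u ≤ N → b ≤ a + m → 9 * a ≤ 11 * m → 50 * m ≤ N →
              N ≤ 4 * g
    arithmetic u g b a m u+g+b≡N 2u≤N b≤a+m 9a≤11m 50m≤N = *-cancelˡ-≤ 41 (+-cancelʳ-≤ (4 * N) _ _ (begin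
      41 * N + 4 * N                 ≡⟨ solve (N ∷ []) ⟩
      45 * N                         ≤⟨ *-monoʳ-≤ 45 N≤2g+2b ⟩
      45 * (2 * g + 2 * b)           ≡⟨ solve (g ∷ b ∷ []) ⟩
      90 * g + 10 * (9 * b)
        ≤⟨ +-monoʳ-≤ (90 * g) (*-monoʳ-≤ 10 (≤-trans (*-monoʳ-≤ 9 b≤a+m) 9[a+m]≤20m)) ⟩
      90 * g + 10 * (20 * m)         ≡⟨ solve (g ∷ m ∷ []) ⟩
      90 * g + 4 * (50 * m)          ≤⟨ +-mono-≤ (*-monoˡ-≤ g (m≤m+n 90 74)) (*-monoʳ-≤ 4 50m≤N) ⟩
      164 * g + 4 * N                ≡⟨ solve (g ∷ N ∷ []) ⟩
      41 * (4 * g) + 4 * N           ∎))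
      where
      N≤2g+2b : N ≤ 2 * g + 2 * b
      N≤2g+2b = +-cancelˡ-≤ N _ _ (begin
        N + N                              ≡⟨ cong₂ _+_ (≡-sym u+g+b≡N) (≡-sym u+g+b≡N) ⟩
        (u + (g + b)) + (u + (g + b))      ≡⟨ solve (u ∷ g ∷ b ∷ []) ⟩
        2 * u + (2 * g + 2 * b)            ≤⟨ +-monoˡ-≤ (2 * g + 2 * b) 2u≤N ⟩
        N + (2 * g + 2 * b)                ∎)
      9[a+m]≤20m : 9 * (a + m) ≤ 20 * m
      9[a+m]≤20m = begin
        9 * (a + m)          ≡⟨ *-distribˡ-+ 9 a m ⟩
        9 * a + 9 * m        ≤⟨ +-monoˡ-≤ (9 * m) 9a≤11m ⟩
        11 * m + 9 * m       ≡⟨ solve (m ∷ []) ⟩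
        20 * m               ∎

lemma5p1 : (c : ℚ) → Q.0ℚ < c → c Q.≤ Q.1ℚ →
    (m N : ℕ) → 1 ≤ m → ℕ→ℚ m Q.* ℕ→ℚ 100 Q.≤ c Q.* ℕ→ℚ N →
    (G : Graph N) → IsExpander c G → MinDegOn≥ all G 3 →
    (E₀ : Graph N) → E₀ ⊆ₑ G → edgeCount E₀ ≡ m →
    Σ (VSet N) λ V → Σ (Graph N) λ G' →
      IsSubgraphMinus G E₀ V G' ×
      N ≤ 2 * countB V ×
      MinDegOn≥ V G' 2 ×
      N ≤ 4 * countB (λ v → V v ∧ (3 ≤ᵇ deg G' v)) ×
      IsExpanderOn (c Q.* ((+ 1) / 10)) V G'
lemma5p1 (mkℚ (+ zero) d cp) (Q.*<* (ℤ.+<+ ()))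
lemma5p1 (mkℚ ℤ.-[1+ _ ] d cp) (Q.*<* ())
lemma5p1 (mkℚ (+ suc p) d cp) _ c≤1 m N m≥1 m-sparse G G-expander G-deg≥3 E₀ E₀⊆G |E₀|≡m =
  V , G' , ∖ₑ-induced-isSubgraphMinus G E₀ V , V-large , G'-min-degree , Good-large ,
  expands⇒isExpanderOn {suc p} {d} {cp} {V = V} {G'} G'-expands
  where
  open Deletion (mkℚ≤1⇒≤ c≤1) G E₀ E₀⊆G (subst (1 ≤_) (≡-sym |E₀|≡m) m≥1)
    (subst (λ k → suc d * (100 * k) ≤ suc p * N) (≡-sym |E₀|≡m) (ℕ→ℚ-*-≤-mkℚ-* m 100 N m-sparse))
    (isExpanderOn⇒Expands {V = all} {G} G-expander) G-deg≥3
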